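{- If $k,m,n$ are integers with $4\leq m<k$ and $2^k+2^{m-1}\leq n<2^k+2^{m-1}+h_{m-3}$, then $s_2(n)<F_{m+2}+(k-m)F_m$.
   Context: $s_2$ is Stern's diatomic sequence: $s_2(0)=0$, $s_2(1)=1$, and for $n\ge 2$, $s_2(n)$ is the number of words $d_kd_{k-1}\cdots d_0$ over $\{0,1,2\}$ with $d_k\ne0$ and $\sum d_i2^i=n-1$. Here (with base $b=2$) $h_1=h_2=1$ and $h_j=1+\sum_{i=0}^{\lfloor (j-3)/2\rfloor}2^{j-2-2i}$ for $j\ge3$. $F_j$ are the Fibonacci numbers with $F_1=F_2=1$. (In the paper's notation, the bounds are $2^k+G_{m-1}(m-3)$ and $H_k(m)$ with $b=2$.) -}

module Defs where

open import Data.Nat using (ℕ; zero; suc; _+_; _*_; _∸_; _^_; _/_)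
open import Data.Nat.Properties using (_≟_)
open import Data.List using (List; []; _∷_; map; concatMap; upTo; last)
open import Data.Nat.ListAction using (sum)
open import Data.Maybe using (Maybe; just; nothing)
open import Data.Bool using (Bool; true; false)
open import Relation.Nullary.Decidable using (does)

-- Digit words are lists d₀ ∷ d₁ ∷ … ∷ dₖ (least significant digit first).

val : List ℕ → ℕ
val []       = 0
val (d ∷ ds) = d + 2 * val ds

words : ℕ → List (List ℕ)
words zero    = [] ∷ []
words (suc j) = concatMap (λ w → map (_∷ w) (0 ∷ 1 ∷ 2 ∷ [])) (words j)

leadingNonzero : List ℕ → Bool
leadingNonzero w with last w
... | nothing      = false
... | just zero    = false
... | just (suc _) = true

good : ℕ → List ℕ → Bool
good N w with leadingNonzero w
... | false = false
... | true  = does (val w ≟ N)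

-- A word with d_k ≠ 0 has value ≥ 2^k > k, so its length k+1 is ≤ N; we
-- therefore count over all lengths 1 … N+1 (lengths 0 … N), which is exhaustive.
countTrue : {A : Set} → (A → Bool) → List A → ℕ
countTrue p []       = 0
countTrue p (x ∷ xs) with p x
... | true  = suc (countTrue p xs)
... | false = countTrue p xs

hyperbinaryCount : ℕ → ℕ
hyperbinaryCount N = sum (map (λ j → countTrue (good N) (words j)) (upTo (suc N)))

s₂ : ℕ → ℕ
s₂ zero          = 0
s₂ (suc zero)    = 1
s₂ (suc (suc n)) = hyperbinaryCount (suc n)   -- n+2 ≥ 2, count for (n+2)-1

F : ℕ → ℕ
F zero          = 0
F (suc zero)    = 1
F (suc (suc j)) = F (suc j) + F j

sumBelow : ℕ → (ℕ → ℕ) → ℕ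
sumBelow zero    f = 0
sumBelow (suc t) f = sumBelow t f + f t

-- h₁ = h₂ = 1, h_j = 1 + Σ_{i=0}^{⌊(j-3)/2⌋} 2^{j-2-2i} for j ≥ 3  (h₀ unused; set to 1)
h : ℕ → ℕ
h zero                = 1
h (suc zero)          = 1
h (suc (suc zero))    = 1
h (suc (suc (suc j))) = 1 + sumBelow (suc (j / 2)) (λ i → 2 ^ ((suc j) ∸ 2 * i))

-- Splitting off the last digit of a hyperbinary word gives the Stern recurrences
-- s₂ (2n) = s₂ n and s₂ (2n+1) = s₂ n + s₂ (n+1). By induction on j they give, for t + w = 2^j,
-- s₂ (2^j a + t) = s₂ a · s₂ w + s₂ (a+1) · s₂ t, and s₂ n ≤ F (j+1) for n ≤ 2^j.
-- Write n = 2^k + r with r = 2^(m−1) + t ≤ 2^m. Taking a = 2^(k−m) and a = 1 in the splitting identity gives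
-- s₂ n = s₂ (2^m + r) + (k − m) · s₂ r ≤ F (m+2) + (k − m) · s₂ r, so it suffices that s₂ r < F m.
-- This is the case k = 0 of  s₂ (2^(i+1) · prefix k + t) < F (2k + i + 4)  for t < h (i+1), where
-- prefix k = 100(01)^k in binary; that bound is proved by induction on i. Since h (i+3) = 2^(i+1) + h (i+1),
-- either t < 2^(i+1), and the splitting identity together with the bound s₂ ≤ F applies, or
-- 2^(i+3) · prefix k + t = 2^(i+1) · prefix (k+1) + (t − 2^(i+1)) with t − 2^(i+1) < h (i+1).
-- The closed forms s₂ (prefix k) = 4 F (2k) + F (2k−1) and s₂ (prefix k + 1) = F (2k) + 3 F (2k−1)
-- reduce the remaining inequalities to Fibonacci arithmetic.

module Submission where

open import Data.Bool.Base using (Bool; true; false; _∧_)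
open import Data.List.Base using (List; []; _∷_; _++_; map; concatMap; applyUpTo; last)
open import Data.Nat.Base
open import Data.Nat.DivMod using (m/n≡1+[m∸n]/n)
open import Data.Nat.ListAction using (sum)
open import Data.Nat.Properties
open import Data.Nat.Tactic.RingSolver using (solve-∀)
open import Data.Maybe.Base using (just; nothing)
open import Data.Product.Base using (Σ-syntax; _×_; _,_; proj₁; proj₂)
open import Function.Base using (_∘_)
open import Relation.Binary.PropositionalEquality
open import Relation.Nullary.Decidable using (yes; no)
open import Relation.Nullary.Negation using (contradiction)
open import Algebra.Properties.CommutativeSemigroup +-commutativeSemigroup using (interchange; x∙yz≈y∙xz)

open import Defs

toℕ : Bool → ℕ
toℕ false = 0
toℕ true  = 1

countTrue-∷ : ∀ {A : Set} (p : A → Bool) x xs → countTrue p (x ∷ xs) ≡ toℕ (p x) + countTrue p xs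
countTrue-∷ p x xs with p x
... | true  = refl
... | false = refl

countTrue-++ : ∀ {A : Set} (p : A → Bool) xs ys → countTrue p (xs ++ ys) ≡ countTrue p xs + countTrue p ys
countTrue-++ p []       ys = refl
countTrue-++ p (x ∷ xs) ys = begin
  countTrue p (x ∷ xs ++ ys)                  ≡⟨ countTrue-∷ p x (xs ++ ys) ⟩
  toℕ (p x) + countTrue p (xs ++ ys)          ≡⟨ cong (toℕ (p x) +_) (countTrue-++ p xs ys) ⟩
  toℕ (p x) + (countTrue p xs + countTrue p ys) ≡⟨ +-assoc (toℕ (p x)) _ _ ⟨
  (toℕ (p x) + countTrue p xs) + countTrue p ys ≡⟨ cong (_+ countTrue p ys) (countTrue-∷ p x xs) ⟨
  countTrue p (x ∷ xs) + countTrue p ys       ∎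
  where open ≡-Reasoning

countTrue≡sum : ∀ {A : Set} (p : A → Bool) xs → countTrue p xs ≡ sum (map (toℕ ∘ p) xs)
countTrue≡sum p []       = refl
countTrue≡sum p (x ∷ xs) = trans (countTrue-∷ p x xs) (cong (toℕ (p x) +_) (countTrue≡sum p xs))

sum-map-+ : ∀ {A : Set} (f g : A → ℕ) xs → sum (map (λ x → f x + g x) xs) ≡ sum (map f xs) + sum (map g xs)
sum-map-+ f g []       = refl
sum-map-+ f g (x ∷ xs) = trans (cong (f x + g x +_) (sum-map-+ f g xs)) (interchange (f x) (g x) _ _)

applyUpTo-cong : ∀ {f g : ℕ → ℕ} → (∀ j → f j ≡ g j) → ∀ L → applyUpTo f L ≡ applyUpTo g L
applyUpTo-cong f≗g zero    = refl
applyUpTo-cong f≗g (suc L) = cong₂ _∷_ (f≗g 0) (applyUpTo-cong (f≗g ∘ suc) L)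

sum-applyUpTo-+ : ∀ (f g : ℕ → ℕ) L →
  sum (applyUpTo (λ j → f j + g j) L) ≡ sum (applyUpTo f L) + sum (applyUpTo g L)
sum-applyUpTo-+ f g zero    = refl
sum-applyUpTo-+ f g (suc L) =
  trans (cong (f 0 + g 0 +_) (sum-applyUpTo-+ (f ∘ suc) (g ∘ suc) L)) (interchange (f 0) (g 0) _ _)

map-applyUpTo : ∀ (g f : ℕ → ℕ) L → map g (applyUpTo f L) ≡ applyUpTo (g ∘ f) L
map-applyUpTo g f zero    = refl
map-applyUpTo g f (suc L) = cong (g (f 0) ∷_) (map-applyUpTo g (f ∘ suc) L)

sumBelow-suc : ∀ t f → sumBelow (suc t) f ≡ f 0 + sumBelow t (f ∘ suc)
sumBelow-suc zero    f = +-comm 0 (f 0)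
sumBelow-suc (suc t) f = trans (cong (_+ f (suc t)) (sumBelow-suc t f)) (+-assoc (f 0) _ _)

sumBelow-cong : ∀ t {f g} → (∀ i → f i ≡ g i) → sumBelow t f ≡ sumBelow t g
sumBelow-cong zero    f≗g = refl
sumBelow-cong (suc t) f≗g = cong₂ _+_ (sumBelow-cong t f≗g) (f≗g t)

double-≡ᵇ-double : ∀ m n → (2 * m ≡ᵇ 2 * n) ≡ (m ≡ᵇ n)
double-≡ᵇ-double zero    zero    = refl
double-≡ᵇ-double zero    (suc n) = refl
double-≡ᵇ-double (suc m) zero    = refl
double-≡ᵇ-double (suc m) (suc n) rewrite +-suc m (m + 0) | +-suc n (n + 0) = double-≡ᵇ-double m n

double-≡ᵇ-double+1 : ∀ m n → (2 * m ≡ᵇ 1 + 2 * n) ≡ false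
double-≡ᵇ-double+1 zero    n       = refl
double-≡ᵇ-double+1 (suc m) zero    rewrite +-suc m (m + 0) = refl
double-≡ᵇ-double+1 (suc m) (suc n) rewrite +-suc m (m + 0) | +-suc n (n + 0) = double-≡ᵇ-double+1 m n

double+1-≡ᵇ-double : ∀ m n → (1 + 2 * m ≡ᵇ 2 * n) ≡ false
double+1-≡ᵇ-double m zero    = refl
double+1-≡ᵇ-double zero (suc n) rewrite +-suc n (n + 0) = refl
double+1-≡ᵇ-double (suc m) (suc n) rewrite +-suc m (m + 0) | +-suc n (n + 0) = double+1-≡ᵇ-double m n

double-≡ᵇ-double+2 : ∀ m n → (2 * m ≡ᵇ 2 + 2 * n) ≡ (m ≡ᵇ 1 + n)
double-≡ᵇ-double+2 m n = trans (cong (2 * m ≡ᵇ_) (sym (*-suc 2 n))) (double-≡ᵇ-double m (1 + n))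

data EvenOdd : ℕ → Set where
  even : ∀ m → EvenOdd (2 * m)
  odd  : ∀ m → EvenOdd (1 + 2 * m)

evenOdd : ∀ n → EvenOdd n
evenOdd zero    = even 0
evenOdd (suc n) with evenOdd n
... | even m = odd m
... | odd m  = subst EvenOdd (*-suc 2 m) (even (suc m))

even-complement : ∀ u w P → 2 * u + w ≡ 2 * P → Σ[ v ∈ ℕ ] w ≡ 2 * v × u + v ≡ P
even-complement u w P eq with evenOdd w
... | even v = v , refl , *-cancelˡ-≡ (u + v) P 2 (trans (*-distribˡ-+ 2 u v) eq)
... | odd v  = contradiction (trans (sym eq) (2u+[1+2v]≡1+2[u+v] u v)) (even≢odd P (u + v))
  where
  2u+[1+2v]≡1+2[u+v] : ∀ u v → 2 * u + (1 + 2 * v) ≡ 1 + 2 * (u + v)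
  2u+[1+2v]≡1+2[u+v] = solve-∀

odd-complement : ∀ u w P → 1 + 2 * u + w ≡ 2 * P → Σ[ v ∈ ℕ ] w ≡ 1 + 2 * v × 1 + u + v ≡ P
odd-complement u w P eq with evenOdd w
... | even v = contradiction (trans (sym eq) (cong suc (sym (*-distribˡ-+ 2 u v)))) (even≢odd P (u + v))
... | odd v  = v , refl , *-cancelˡ-≡ (1 + u + v) P 2 (trans (2[1+u+v]≡[1+2u]+[1+2v] u v) eq)
  where
  2[1+u+v]≡[1+2u]+[1+2v] : ∀ u v → 2 * (1 + u + v) ≡ 1 + 2 * u + (1 + 2 * v)
  2[1+u+v]≡[1+2u]+[1+2v] = solve-∀

P+a≤2*P : ∀ P {a} → a ≤ P → P + a ≤ 2 * P
P+a≤2*P P a≤P = ≤-trans (+-monoʳ-≤ P a≤P) (≤-reflexive (cong (P +_) (sym (+-identityʳ P))))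

<-offset : ∀ c {x y a b} → a ≡ c + x → b ≡ c + y → x < y → a < b
<-offset c refl refl x<y = +-monoʳ-< c x<y


-- Hyperbinary words and the Stern recurrences

good≡ : ∀ N w → good N w ≡ leadingNonzero w ∧ (val w ≡ᵇ N)
good≡ N w with leadingNonzero w
... | true  = refl
... | false = refl

leadingNonzero-∷ : ∀ d x xs → leadingNonzero (d ∷ x ∷ xs) ≡ leadingNonzero (x ∷ xs)
leadingNonzero-∷ d x xs with last (x ∷ xs)
... | nothing      = refl
... | just zero    = refl
... | just (suc _) = refl

good-∷ : ∀ N d x xs → good N (d ∷ x ∷ xs) ≡ leadingNonzero (x ∷ xs) ∧ (d + 2 * val (x ∷ xs) ≡ᵇ N)
good-∷ N d x xs = trans (good≡ N (d ∷ x ∷ xs)) (cong (_∧ (d + 2 * val (x ∷ xs) ≡ᵇ N)) (leadingNonzero-∷ d x xs))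

extensions : List ℕ → List (List ℕ)
extensions w = (0 ∷ w) ∷ (1 ∷ w) ∷ (2 ∷ w) ∷ []

countTrue-extensions : ∀ (p : List ℕ → Bool) w →
  countTrue p (extensions w) ≡ toℕ (p (0 ∷ w)) + (toℕ (p (1 ∷ w)) + (toℕ (p (2 ∷ w)) + 0))
countTrue-extensions p w =
  trans (countTrue-∷ p (0 ∷ w) _) (cong (toℕ (p (0 ∷ w)) +_)
    (trans (countTrue-∷ p (1 ∷ w) _) (cong (toℕ (p (1 ∷ w)) +_) (countTrue-∷ p (2 ∷ w) []))))

good-extensions-0 : ∀ x xs → countTrue (good 0) (extensions (x ∷ xs)) ≡ toℕ (good 0 (x ∷ xs))
good-extensions-0 x xs
  rewrite countTrue-extensions (good 0) (x ∷ xs)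
        | good-∷ 0 0 x xs | good-∷ 0 1 x xs | good-∷ 0 2 x xs | good≡ 0 (x ∷ xs)
  with leadingNonzero (x ∷ xs)
... | false = refl
... | true  rewrite double-≡ᵇ-double (val (x ∷ xs)) 0 = +-identityʳ _

good-extensions-odd : ∀ m x xs → countTrue (good (1 + 2 * m)) (extensions (x ∷ xs)) ≡ toℕ (good m (x ∷ xs))
good-extensions-odd m x xs
  rewrite countTrue-extensions (good (1 + 2 * m)) (x ∷ xs)
        | good-∷ (1 + 2 * m) 0 x xs | good-∷ (1 + 2 * m) 1 x xs | good-∷ (1 + 2 * m) 2 x xs
        | good≡ m (x ∷ xs)
  with leadingNonzero (x ∷ xs)
... | false = refl
... | true  rewrite double-≡ᵇ-double+1 (val (x ∷ xs)) m | double-≡ᵇ-double (val (x ∷ xs)) m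
                  | double+1-≡ᵇ-double (val (x ∷ xs)) m = +-identityʳ _

good-extensions-even : ∀ m x xs → countTrue (good (2 + 2 * m)) (extensions (x ∷ xs)) ≡
                  toℕ (good (1 + m) (x ∷ xs)) + toℕ (good m (x ∷ xs))
good-extensions-even m x xs
  rewrite countTrue-extensions (good (2 + 2 * m)) (x ∷ xs)
        | good-∷ (2 + 2 * m) 0 x xs | good-∷ (2 + 2 * m) 1 x xs | good-∷ (2 + 2 * m) 2 x xs
        | good≡ m (x ∷ xs) | good≡ (1 + m) (x ∷ xs)
  with leadingNonzero (x ∷ xs)
... | false = refl
... | true  rewrite double-≡ᵇ-double+2 (val (x ∷ xs)) m | double-≡ᵇ-double+1 (val (x ∷ xs)) m
                  | double-≡ᵇ-double (val (x ∷ xs)) m = cong (toℕ (val (x ∷ xs) ≡ᵇ 1 + m) +_) (+-identityʳ _)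

-- words (2 + j) unfolds to this shape, and every word of `concatMap extensions ws` is nonempty,
-- so the counts above apply to its extensions.
countTrue-extensions² : ∀ (p : List ℕ → Bool) (g : List ℕ → ℕ) →
  (∀ x xs → countTrue p (extensions (x ∷ xs)) ≡ g (x ∷ xs)) →
  ∀ ws → countTrue p (concatMap extensions (concatMap extensions ws)) ≡ sum (map g (concatMap extensions ws))
countTrue-extensions² p g count-g []       = refl
countTrue-extensions² p g count-g (w ∷ ws) = begin
  countTrue p (extensions (0 ∷ w) ++ (extensions (1 ∷ w) ++ (extensions (2 ∷ w) ++ rest)))
    ≡⟨ countTrue-++ p (extensions (0 ∷ w)) _ ⟩
  countTrue p (extensions (0 ∷ w)) + countTrue p (extensions (1 ∷ w) ++ (extensions (2 ∷ w) ++ rest))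
    ≡⟨ cong₂ _+_ (count-g 0 w) (countTrue-++ p (extensions (1 ∷ w)) _) ⟩
  g (0 ∷ w) + (countTrue p (extensions (1 ∷ w)) + countTrue p (extensions (2 ∷ w) ++ rest))
    ≡⟨ cong (g (0 ∷ w) +_) (cong₂ _+_ (count-g 1 w) (countTrue-++ p (extensions (2 ∷ w)) rest)) ⟩
  g (0 ∷ w) + (g (1 ∷ w) + (countTrue p (extensions (2 ∷ w)) + countTrue p rest))
    ≡⟨ cong (λ z → g (0 ∷ w) + (g (1 ∷ w) + z)) (cong₂ _+_ (count-g 2 w) (countTrue-extensions² p g count-g ws)) ⟩
  g (0 ∷ w) + (g (1 ∷ w) + (g (2 ∷ w) + sum (map g (concatMap extensions ws)))) ∎
  where
  open ≡-Reasoning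
  rest : List (List ℕ)
  rest = concatMap extensions (concatMap extensions ws)

count : ℕ → ℕ → ℕ
count j N = countTrue (good N) (words j)

countUpTo : ℕ → ℕ → ℕ
countUpTo L N = sum (applyUpTo (λ j → count (suc j) N) L)

count-zero : ∀ j → count (2 + j) 0 ≡ count (1 + j) 0
count-zero j = trans (countTrue-extensions² (good 0) (toℕ ∘ good 0) good-extensions-0 (words j))
                     (sym (countTrue≡sum (good 0) (words (1 + j))))

count-odd : ∀ j m → count (2 + j) (1 + 2 * m) ≡ count (1 + j) m
count-odd j m = trans (countTrue-extensions² (good (1 + 2 * m)) (toℕ ∘ good m) (good-extensions-odd m) (words j))
                      (sym (countTrue≡sum (good m) (words (1 + j))))

count-even : ∀ j m → count (2 + j) (2 + 2 * m) ≡ count (1 + j) (1 + m) + count (1 + j) m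
count-even j m = begin
  count (2 + j) (2 + 2 * m)
    ≡⟨ countTrue-extensions² (good (2 + 2 * m)) (λ w → toℕ (good (1 + m) w) + toℕ (good m w))
                              (good-extensions-even m) (words j) ⟩
  sum (map (λ w → toℕ (good (1 + m) w) + toℕ (good m w)) (words (1 + j)))
    ≡⟨ sum-map-+ (toℕ ∘ good (1 + m)) (toℕ ∘ good m) (words (1 + j)) ⟩
  sum (map (toℕ ∘ good (1 + m)) (words (1 + j))) + sum (map (toℕ ∘ good m) (words (1 + j)))
    ≡⟨ cong₂ _+_ (countTrue≡sum (good (1 + m)) (words (1 + j))) (countTrue≡sum (good m) (words (1 + j))) ⟨
  count (1 + j) (1 + m) + count (1 + j) m ∎
  where open ≡-Reasoning

count-1≡0 : ∀ N → 3 ≤ N → count 1 N ≡ 0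
count-1≡0 (suc (suc (suc N))) _ = refl
count-1≡0 1 (s≤s ())
count-1≡0 2 (s≤s (s≤s ()))

countUpTo-zero : ∀ L → countUpTo L 0 ≡ 0
countUpTo-zero zero    = refl
countUpTo-zero (suc L) = trans (cong sum (applyUpTo-cong count-zero L)) (countUpTo-zero L)

countUpTo-odd : ∀ L m → countUpTo (suc L) (1 + 2 * m) ≡ count 1 (1 + 2 * m) + countUpTo L m
countUpTo-odd L m = cong (count 1 (1 + 2 * m) +_) (cong sum (applyUpTo-cong (λ j → count-odd j m) L))

countUpTo-even : ∀ L m →
  countUpTo (suc L) (2 + 2 * m) ≡ count 1 (2 + 2 * m) + (countUpTo L (1 + m) + countUpTo L m)
countUpTo-even L m = cong (count 1 (2 + 2 * m) +_)
  (trans (cong sum (applyUpTo-cong (λ j → count-even j m) L))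
         (sum-applyUpTo-+ (λ j → count (suc j) (1 + m)) (λ j → count (suc j) m) L))

countUpTo-suc : ∀ L N → N ≤ L → countUpTo (suc L) N ≡ countUpTo L N
countUpTo-suc L N N≤L with evenOdd N
countUpTo-suc L .(2 * 0) _ | even zero = trans (countUpTo-zero (suc L)) (sym (countUpTo-zero L))
countUpTo-suc zero .(1 + 2 * m) () | odd m
countUpTo-suc (suc L) .(1 + 2 * m) (s≤s 2m≤L) | odd m = begin
  countUpTo (2 + L) (1 + 2 * m)        ≡⟨ countUpTo-odd (suc L) m ⟩
  count 1 (1 + 2 * m) + countUpTo (1 + L) m ≡⟨ cong (count 1 (1 + 2 * m) +_) (countUpTo-suc L m m≤L) ⟩
  count 1 (1 + 2 * m) + countUpTo L m  ≡⟨ countUpTo-odd L m ⟨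
  countUpTo (1 + L) (1 + 2 * m)        ∎
  where
  open ≡-Reasoning
  m≤L : m ≤ L
  m≤L = ≤-trans (m≤n*m m 2) 2m≤L
countUpTo-suc zero .(2 * suc m) () | even (suc m)
countUpTo-suc (suc L) .(2 * suc m) N≤L | even (suc m) =
  subst (λ N → countUpTo (2 + L) N ≡ countUpTo (1 + L) N) (sym (*-suc 2 m))
        (countUpTo-suc-even (subst (_≤ suc L) (*-suc 2 m) N≤L))
  where
  open ≡-Reasoning
  countUpTo-suc-even : 2 + 2 * m ≤ 1 + L → countUpTo (2 + L) (2 + 2 * m) ≡ countUpTo (1 + L) (2 + 2 * m)
  countUpTo-suc-even (s≤s 1+2m≤L) = begin
    countUpTo (2 + L) (2 + 2 * m)
      ≡⟨ countUpTo-even (suc L) m ⟩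
    count 1 (2 + 2 * m) + (countUpTo (1 + L) (1 + m) + countUpTo (1 + L) m)
      ≡⟨ cong (count 1 (2 + 2 * m) +_) (cong₂ _+_ (countUpTo-suc L (1 + m) 1+m≤L) (countUpTo-suc L m m≤L)) ⟩
    count 1 (2 + 2 * m) + (countUpTo L (1 + m) + countUpTo L m)
      ≡⟨ countUpTo-even L m ⟨
    countUpTo (1 + L) (2 + 2 * m) ∎
    where
    1+m≤L : 1 + m ≤ L
    1+m≤L = ≤-trans (s≤s (m≤n*m m 2)) 1+2m≤L
    m≤L : m ≤ L
    m≤L = ≤-trans (n≤1+n m) 1+m≤L

countUpTo-stable : ∀ N L → N ≤ L → countUpTo L N ≡ countUpTo N N
countUpTo-stable N zero    z≤n   = refl
countUpTo-stable N (suc L) N≤1+L with N ≟ suc L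
... | yes refl = refl
... | no N≢1+L = trans (countUpTo-suc L N N≤L) (countUpTo-stable N L N≤L)
  where
  N≤L : N ≤ L
  N≤L = ≤-pred (≤∧≢⇒< N≤1+L N≢1+L)

s₂≡countUpTo : ∀ n → s₂ (2 + n) ≡ countUpTo (1 + n) (1 + n)
s₂≡countUpTo n = cong sum (map-applyUpTo (λ j → count j (1 + n)) suc (1 + n))

s₂-double : ∀ n → s₂ (2 * n) ≡ s₂ n
s₂-double zero          = refl
s₂-double (suc zero)    = refl
s₂-double (suc (suc k)) = begin
  s₂ (2 * (2 + k))                               ≡⟨ cong s₂ (*-suc 2 (suc k)) ⟩
  s₂ (2 + 2 * (1 + k))                           ≡⟨ s₂≡countUpTo (2 * (1 + k)) ⟩
  countUpTo (1 + 2 * (1 + k)) (1 + 2 * (1 + k))  ≡⟨ countUpTo-odd (2 * (1 + k)) (1 + k) ⟩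
  count 1 (1 + 2 * (1 + k)) + countUpTo (2 * (1 + k)) (1 + k)
    ≡⟨ cong (_+ countUpTo (2 * (1 + k)) (1 + k)) (count-1≡0 (1 + 2 * (1 + k)) (s≤s (*-monoʳ-≤ 2 (s≤s (z≤n {k}))))) ⟩
  countUpTo (2 * (1 + k)) (1 + k)                ≡⟨ countUpTo-stable (1 + k) (2 * (1 + k)) (m≤n*m (1 + k) 2) ⟩
  countUpTo (1 + k) (1 + k)                      ≡⟨ s₂≡countUpTo k ⟨
  s₂ (2 + k)                                     ∎
  where open ≡-Reasoning

s₂-double+1 : ∀ n → s₂ (1 + 2 * n) ≡ s₂ n + s₂ (1 + n)
s₂-double+1 zero          = refl
s₂-double+1 (suc zero)    = refl
s₂-double+1 (suc (suc k)) = begin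
  s₂ (1 + 2 * (2 + k))                           ≡⟨ cong (s₂ ∘ suc) (*-suc 2 (suc k)) ⟩
  s₂ (2 + (1 + 2 * (1 + k)))                     ≡⟨ s₂≡countUpTo (1 + 2 * (1 + k)) ⟩
  countUpTo (2 + 2 * (1 + k)) (2 + 2 * (1 + k))  ≡⟨ countUpTo-even (1 + 2 * (1 + k)) (1 + k) ⟩
  count 1 (2 + 2 * (1 + k)) + (countUpTo L (2 + k) + countUpTo L (1 + k))
    ≡⟨ cong₂ _+_ (count-1≡0 (2 + 2 * (1 + k)) (s≤s (s≤s (s≤s z≤n))))
                 (cong₂ _+_ (countUpTo-stable (2 + k) L (s≤s (m≤n*m (1 + k) 2)))
                            (countUpTo-stable (1 + k) L (≤-trans (m≤n*m (1 + k) 2) (n≤1+n _)))) ⟩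
  countUpTo (2 + k) (2 + k) + countUpTo (1 + k) (1 + k)
    ≡⟨ +-comm (countUpTo (2 + k) (2 + k)) _ ⟩
  countUpTo (1 + k) (1 + k) + countUpTo (2 + k) (2 + k)
    ≡⟨ cong₂ _+_ (s₂≡countUpTo k) (s₂≡countUpTo (1 + k)) ⟨
  s₂ (2 + k) + s₂ (3 + k)                        ∎
  where
  open ≡-Reasoning
  L : ℕ
  L = 1 + 2 * (1 + k)


-- The splitting identity and Fibonacci bounds for s₂

s₂-split : ∀ j a t w → t + w ≡ 2 ^ j → s₂ (2 ^ j * a + t) ≡ s₂ a * s₂ w + s₂ (1 + a) * s₂ t
s₂-split zero a zero          .1 refl = trans (cong s₂ (1*a+0≡a a)) (sym (x*1+y*0≡x (s₂ a) (s₂ (1 + a))))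
  where
  1*a+0≡a : ∀ a → 1 * a + 0 ≡ a
  1*a+0≡a = solve-∀
  x*1+y*0≡x : ∀ x y → x * 1 + y * 0 ≡ x
  x*1+y*0≡x = solve-∀
s₂-split zero a (suc zero)    .0 refl = trans (cong s₂ (1*a+1≡1+a a)) (sym (x*0+y*1≡y (s₂ a) (s₂ (1 + a))))
  where
  1*a+1≡1+a : ∀ a → 1 * a + 1 ≡ 1 + a
  1*a+1≡1+a = solve-∀
  x*0+y*1≡y : ∀ x y → x * 0 + y * 1 ≡ y
  x*0+y*1≡y = solve-∀
s₂-split zero a (suc (suc t)) w ()
s₂-split (suc j) a t w t+w≡2^[1+j] with evenOdd t
... | even u with even-complement u w (2 ^ j) t+w≡2^[1+j]
...   | v , refl , u+v≡2^j = begin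
  s₂ (2 ^ suc j * a + 2 * u)                     ≡⟨ cong s₂ (factor-2 (2 ^ j) a u) ⟩
  s₂ (2 * (2 ^ j * a + u))                       ≡⟨ s₂-double (2 ^ j * a + u) ⟩
  s₂ (2 ^ j * a + u)                             ≡⟨ s₂-split j a u v u+v≡2^j ⟩
  s₂ a * s₂ v + s₂ (1 + a) * s₂ u                ≡⟨ cong₂ (λ x y → s₂ a * x + s₂ (1 + a) * y) (s₂-double v) (s₂-double u) ⟨
  s₂ a * s₂ (2 * v) + s₂ (1 + a) * s₂ (2 * u)    ∎
  where
  open ≡-Reasoning
  factor-2 : ∀ P a u → 2 * P * a + 2 * u ≡ 2 * (P * a + u)
  factor-2 = solve-∀
s₂-split (suc j) a t w t+w≡2^[1+j] | odd u with odd-complement u w (2 ^ j) t+w≡2^[1+j]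
...   | v , refl , 1+u+v≡2^j = begin
  s₂ (2 ^ suc j * a + (1 + 2 * u))                 ≡⟨ cong s₂ (factor-2 (2 ^ j) a u) ⟩
  s₂ (1 + 2 * (2 ^ j * a + u))                     ≡⟨ s₂-double+1 (2 ^ j * a + u) ⟩
  s₂ (2 ^ j * a + u) + s₂ (1 + (2 ^ j * a + u))    ≡⟨ cong (λ x → s₂ (2 ^ j * a + u) + s₂ x) (+-suc (2 ^ j * a) u) ⟨
  s₂ (2 ^ j * a + u) + s₂ (2 ^ j * a + (1 + u))
    ≡⟨ cong₂ _+_ (s₂-split j a u (1 + v) (trans (+-suc u v) 1+u+v≡2^j)) (s₂-split j a (1 + u) v 1+u+v≡2^j) ⟩
  (s₂ a * s₂ (1 + v) + s₂ (1 + a) * s₂ u) + (s₂ a * s₂ v + s₂ (1 + a) * s₂ (1 + u))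
    ≡⟨ regroup (s₂ a) (s₂ (1 + a)) (s₂ v) (s₂ (1 + v)) (s₂ u) (s₂ (1 + u)) ⟩
  s₂ a * (s₂ v + s₂ (1 + v)) + s₂ (1 + a) * (s₂ u + s₂ (1 + u))
    ≡⟨ cong₂ (λ x y → s₂ a * x + s₂ (1 + a) * y) (s₂-double+1 v) (s₂-double+1 u) ⟨
  s₂ a * s₂ (1 + 2 * v) + s₂ (1 + a) * s₂ (1 + 2 * u) ∎
  where
  open ≡-Reasoning
  factor-2 : ∀ P a u → 2 * P * a + (1 + 2 * u) ≡ 1 + 2 * (P * a + u)
  factor-2 = solve-∀
  regroup : ∀ x y v v′ u u′ → (x * v′ + y * u) + (x * v + y * u′) ≡ x * (v + v′) + y * (u + u′)
  regroup = solve-∀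

F-mono : ∀ j → F (1 + j) ≤ F (2 + j)
F-mono j = m≤m+n (F (suc j)) (F j)

mutual
  s₂≤F : ∀ j n → n ≤ 2 ^ j → s₂ n ≤ F (1 + j)
  s₂≤F zero zero                _           = z≤n
  s₂≤F zero (suc zero)          _           = s≤s z≤n
  s₂≤F zero (suc (suc n))       (s≤s ())
  s₂≤F (suc j) n n≤2^[1+j] with evenOdd n
  ... | even m = subst (_≤ F (2 + j)) (sym (s₂-double m))
                       (≤-trans (s₂≤F j m (*-cancelˡ-≤ 2 n≤2^[1+j])) (F-mono j))
  ... | odd m  = subst (_≤ F (2 + j)) (sym (s₂-double+1 m))
                       (s₂+s₂≤F j m (*-cancelˡ-< 2 m (2 ^ j) n≤2^[1+j]))

  s₂+s₂≤F : ∀ j n → n < 2 ^ j → s₂ n + s₂ (1 + n) ≤ F (2 + j)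
  s₂+s₂≤F zero zero    _        = s≤s z≤n
  s₂+s₂≤F zero (suc n) (s≤s ())
  s₂+s₂≤F (suc j) n n<2^[1+j] with evenOdd n
  ... | even m = subst (_≤ F (3 + j)) (sym eq)
                       (+-mono-≤ (s₂+s₂≤F j m m<2^j) (s₂≤F j m (<⇒≤ m<2^j)))
    where
    m<2^j : m < 2 ^ j
    m<2^j = *-cancelˡ-< 2 m (2 ^ j) n<2^[1+j]
    eq : s₂ (2 * m) + s₂ (1 + 2 * m) ≡ (s₂ m + s₂ (1 + m)) + s₂ m
    eq = trans (cong₂ _+_ (s₂-double m) (s₂-double+1 m)) (+-comm (s₂ m) _)
  ... | odd m  = subst (_≤ F (3 + j)) (sym eq)
                       (+-mono-≤ (s₂+s₂≤F j m m<2^j) (s₂≤F j (1 + m) 1+m≤2^j))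
    where
    1+m≤2^j : 1 + m ≤ 2 ^ j
    1+m≤2^j = *-cancelˡ-≤ 2 (subst (_≤ 2 * 2 ^ j) (sym (*-suc 2 m)) n<2^[1+j])
    m<2^j : m < 2 ^ j
    m<2^j = 1+m≤2^j
    eq : s₂ (1 + 2 * m) + s₂ (2 + 2 * m) ≡ (s₂ m + s₂ (1 + m)) + s₂ (1 + m)
    eq = cong₂ _+_ (s₂-double+1 m) (trans (cong s₂ (sym (*-suc 2 m))) (s₂-double (1 + m)))

s₂-2^* : ∀ j n → s₂ (2 ^ j * n) ≡ s₂ n
s₂-2^* zero    n = cong s₂ (*-identityˡ n)
s₂-2^* (suc j) n = trans (cong s₂ (*-assoc 2 (2 ^ j) n)) (trans (s₂-double (2 ^ j * n)) (s₂-2^* j n))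

s₂-2^ : ∀ e → s₂ (2 ^ e) ≡ 1
s₂-2^ e = trans (cong s₂ (sym (*-identityʳ (2 ^ e)))) (s₂-2^* e 1)

s₂-1+2^ : ∀ e → s₂ (1 + 2 ^ e) ≡ 1 + e
s₂-1+2^ zero    = refl
s₂-1+2^ (suc e) = trans (s₂-double+1 (2 ^ e)) (cong₂ _+_ (s₂-2^ e) (s₂-1+2^ e))

s₂-2^[j+e]+ : ∀ j e r → r ≤ 2 ^ j → s₂ (2 ^ (j + e) + r) ≡ s₂ (2 ^ j + r) + e * s₂ r
s₂-2^[j+e]+ j e r r≤2^j = begin
  s₂ (2 ^ (j + e) + r)            ≡⟨ cong (λ x → s₂ (x + r)) (^-distribˡ-+-* 2 j e) ⟩
  s₂ (2 ^ j * 2 ^ e + r)          ≡⟨ s₂-2^j·2^e+r e ⟩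
  s₂ w + (1 + e) * s₂ r           ≡⟨ split-off (s₂ w) (s₂ r) e ⟩
  (s₂ w + 1 * s₂ r) + e * s₂ r    ≡⟨ cong (_+ e * s₂ r) (s₂-2^j·2^e+r 0) ⟨
  s₂ (2 ^ j * 1 + r) + e * s₂ r   ≡⟨ cong (λ x → s₂ (x + r) + e * s₂ r) (*-identityʳ (2 ^ j)) ⟩
  s₂ (2 ^ j + r) + e * s₂ r       ∎
  where
  open ≡-Reasoning
  w : ℕ
  w = 2 ^ j ∸ r
  s₂-2^j·2^e+r : ∀ e → s₂ (2 ^ j * 2 ^ e + r) ≡ s₂ w + (1 + e) * s₂ r
  s₂-2^j·2^e+r e = begin
    s₂ (2 ^ j * 2 ^ e + r)                      ≡⟨ s₂-split j (2 ^ e) r w (m+[n∸m]≡n r≤2^j) ⟩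
    s₂ (2 ^ e) * s₂ w + s₂ (1 + 2 ^ e) * s₂ r   ≡⟨ cong₂ (λ x y → x * s₂ w + y * s₂ r) (s₂-2^ e) (s₂-1+2^ e) ⟩
    1 * s₂ w + (1 + e) * s₂ r                   ≡⟨ cong (_+ (1 + e) * s₂ r) (*-identityˡ (s₂ w)) ⟩
    s₂ w + (1 + e) * s₂ r                       ∎
  split-off : ∀ x y e → x + (1 + e) * y ≡ (x + 1 * y) + e * y
  split-off = solve-∀

s₂-1+4* : ∀ a → s₂ (1 + 4 * a) ≡ s₂ a + (s₂ a + s₂ (1 + a))
s₂-1+4* a = begin
  s₂ (1 + 4 * a)               ≡⟨ cong (s₂ ∘ suc) (*-assoc 2 2 a) ⟩
  s₂ (1 + 2 * (2 * a))         ≡⟨ s₂-double+1 (2 * a) ⟩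
  s₂ (2 * a) + s₂ (1 + 2 * a)  ≡⟨ cong₂ _+_ (s₂-double a) (s₂-double+1 a) ⟩
  s₂ a + (s₂ a + s₂ (1 + a))   ∎
  where open ≡-Reasoning

s₂-2+4* : ∀ a → s₂ (2 + 4 * a) ≡ s₂ a + s₂ (1 + a)
s₂-2+4* a = begin
  s₂ (2 + 4 * a)               ≡⟨ cong s₂ (2+4a≡2[1+2a] a) ⟩
  s₂ (2 * (1 + 2 * a))         ≡⟨ s₂-double (1 + 2 * a) ⟩
  s₂ (1 + 2 * a)               ≡⟨ s₂-double+1 a ⟩
  s₂ a + s₂ (1 + a)            ∎
  where
  open ≡-Reasoning
  2+4a≡2[1+2a] : ∀ a → 2 + 4 * a ≡ 2 * (1 + 2 * a)
  2+4a≡2[1+2a] = solve-∀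


-- The sequence h

h-step : ∀ i → h (3 + i) ≡ 2 ^ (1 + i) + h (1 + i)
h-step zero          = refl
h-step (suc zero)    = refl
h-step (suc (suc i)) = begin
  1 + sumBelow (suc ((2 + i) / 2)) f     ≡⟨ cong (λ q → 1 + sumBelow (suc q) f) (m/n≡1+[m∸n]/n {2 + i} (s≤s (s≤s z≤n))) ⟩
  1 + sumBelow (2 + i / 2) f             ≡⟨ cong (1 +_) (sumBelow-suc (suc (i / 2)) f) ⟩
  1 + (f 0 + sumBelow (suc (i / 2)) (f ∘ suc))
    ≡⟨ cong (λ s → 1 + (f 0 + s)) (sumBelow-cong (suc (i / 2)) f∘suc) ⟩
  1 + (f 0 + sumBelow (suc (i / 2)) (λ k → 2 ^ (1 + i ∸ 2 * k)))
    ≡⟨ x∙yz≈y∙xz 1 (f 0) _ ⟩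
  2 ^ (3 + i) + h (3 + i)                ∎
  where
  open ≡-Reasoning
  f : ℕ → ℕ
  f k = 2 ^ (3 + i ∸ 2 * k)
  f∘suc : ∀ k → f (suc k) ≡ 2 ^ (1 + i ∸ 2 * k)
  f∘suc k = cong (λ x → 2 ^ (3 + i ∸ x)) (*-suc 2 k)

h≤2^ : ∀ i → h (1 + i) ≤ 2 ^ (1 + i)
h≤2^ zero          = s≤s z≤n
h≤2^ (suc zero)    = s≤s z≤n
h≤2^ (suc (suc i)) = begin
  h (3 + i)                  ≡⟨ h-step i ⟩
  P + h (1 + i)              ≤⟨ +-monoʳ-≤ P (h≤2^ i) ⟩
  P + P                      ≤⟨ m≤m+n (P + P) (P + P) ⟩
  (P + P) + (P + P)          ≡⟨ 4P≡2[2P] P ⟩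
  2 ^ (3 + i)                ∎
  where
  open ≤-Reasoning
  P : ℕ
  P = 2 ^ (1 + i)
  4P≡2[2P] : ∀ P → (P + P) + (P + P) ≡ 2 * (2 * P)
  4P≡2[2P] = solve-∀


-- Fibonacci identities

F-+ : ∀ m j → F (suc m + j) ≡ F (suc m) * F (suc j) + F m * F j
F-+ zero          j = a≡1*a+0*b (F (suc j)) (F j)
  where
  a≡1*a+0*b : ∀ a b → a ≡ 1 * a + 0 * b
  a≡1*a+0*b = solve-∀
F-+ (suc zero)    j = a+b≡1*a+1*b (F (suc j)) (F j)
  where
  a+b≡1*a+1*b : ∀ a b → a + b ≡ 1 * a + 1 * b
  a+b≡1*a+1*b = solve-∀
F-+ (suc (suc m)) j = begin
  F (suc (suc m) + j) + F (suc m + j)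
    ≡⟨ cong₂ _+_ (F-+ (suc m) j) (F-+ m j) ⟩
  (F (2 + m) * F (1 + j) + F (1 + m) * F j) + (F (1 + m) * F (1 + j) + F m * F j)
    ≡⟨ collect (F (2 + m)) (F (1 + m)) (F m) (F (1 + j)) (F j) ⟩
  (F (2 + m) + F (1 + m)) * F (1 + j) + (F (1 + m) + F m) * F j ∎
  where
  open ≡-Reasoning
  collect : ∀ x y z a b → (x * a + y * b) + (y * a + z * b) ≡ (x + y) * a + (y + z) * b
  collect = solve-∀

F-combination< : ∀ x z c → x * F 3 + z * F 2 < F c → x * F 4 + z * F 3 < F (suc c) →
                 ∀ i → x * F (3 + i) + z * F (2 + i) < F (c + i)
F-combination< x z c base₀ base₁ i = proj₁ (both i)
  where
  step : ∀ i → x * F (5 + i) + z * F (4 + i) ≡ (x * F (4 + i) + z * F (3 + i)) + (x * F (3 + i) + z * F (2 + i))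
  step i = distribute x z (F (4 + i)) (F (3 + i)) (F (2 + i))
    where
    distribute : ∀ x z a b c → x * (a + b) + z * (b + c) ≡ (x * a + z * b) + (x * b + z * c)
    distribute = solve-∀
  index : ∀ i → c + suc (suc i) ≡ suc (suc (c + i))
  index i = trans (+-suc c (suc i)) (cong suc (+-suc c i))
  retarget : ∀ {a m n} → m ≡ n → a < F m → a < F n
  retarget refl lt = lt
  both : ∀ i → x * F (3 + i) + z * F (2 + i) < F (c + i) × x * F (4 + i) + z * F (3 + i) < F (c + suc i)
  both zero    = retarget (sym (+-identityʳ c)) base₀ , retarget (+-comm 1 c) base₁
  both (suc i) with both i
  ... | lt₀ , lt₁ = lt₁ , subst (_< F (c + suc (suc i))) (sym (step i))
                                (retarget (sym (index i)) (+-mono-< (retarget (+-suc c i) lt₁) lt₀))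

-- F (2k − 1), with the convention F (−1) = 1, so that F (2k + 1) = F (2k) + F (2k − 1) holds for all k.
F[2k-1] : ℕ → ℕ
F[2k-1] zero    = 1
F[2k-1] (suc k) = F (1 + 2 * k)

F[2k+1] : ∀ k → F (1 + 2 * k) ≡ F (2 * k) + F[2k-1] k
F[2k+1] zero    = refl
F[2k+1] (suc k) = trans (cong (F ∘ suc) (*-suc 2 k)) (cong (λ n → F n + F (1 + 2 * k)) (sym (*-suc 2 k)))

F[2k+2] : ∀ k → F (2 * suc k) ≡ (F (2 * k) + F[2k-1] k) + F (2 * k)
F[2k+2] k = trans (cong F (*-suc 2 k)) (cong (_+ F (2 * k)) (F[2k+1] k))

F-pos : ∀ n → 0 < F (suc n)
F-pos zero    = s≤s z≤n
F-pos (suc n) = ≤-trans (F-pos n) (m≤m+n (F (suc n)) (F n))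

F[2k-1]-pos : ∀ k → 0 < F[2k-1] k
F[2k-1]-pos zero    = s≤s z≤n
F[2k-1]-pos (suc k) = F-pos (2 * k)

F[2k]<2*F[2k-1] : ∀ k → F (2 * k) < 2 * F[2k-1] k
F[2k]<2*F[2k-1] zero    = s≤s z≤n
F[2k]<2*F[2k-1] (suc k) = <-offset (2 * p + d)
  (trans (F[2k+2] k) (lhs≡ p d)) (trans (cong (2 *_) (F[2k+1] k)) (rhs≡ p d)) (F[2k-1]-pos k)
  where
  p d : ℕ
  p = F (2 * k)
  d = F[2k-1] k
  lhs≡ : ∀ p d → p + d + p ≡ 2 * p + d + 0
  lhs≡ = solve-∀
  rhs≡ : ∀ p d → 2 * (p + d) ≡ 2 * p + d + d
  rhs≡ = solve-∀


-- Numbers 2^(i+1) · prefix k + t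

prefix : ℕ → ℕ
prefix zero    = 4
prefix (suc k) = 1 + 4 * prefix k

s₂-prefix : ∀ k → s₂ (prefix k) ≡ 4 * F (2 * k) + F[2k-1] k × s₂ (1 + prefix k) ≡ F (2 * k) + 3 * F[2k-1] k
s₂-prefix zero    = refl , refl
s₂-prefix (suc k) with s₂-prefix k
... | eqX , eqY =
  trans (s₂-1+4* (prefix k))
        (trans (cong₂ (λ x y → x + (x + y)) eqX eqY)
               (trans (X-step p d) (sym (cong₂ (λ p′ d′ → 4 * p′ + d′) (F[2k+2] k) (F[2k+1] k))))) ,
  trans (s₂-2+4* (prefix k))
        (trans (cong₂ _+_ eqX eqY)
               (trans (Y-step p d) (sym (cong₂ (λ p′ d′ → p′ + 3 * d′) (F[2k+2] k) (F[2k+1] k)))))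
  where
  p d : ℕ
  p = F (2 * k)
  d = F[2k-1] k
  X-step : ∀ p d → (4 * p + d) + ((4 * p + d) + (p + 3 * d)) ≡ 4 * ((p + d) + p) + (p + d)
  X-step = solve-∀
  Y-step : ∀ p d → (4 * p + d) + (p + 3 * d) ≡ ((p + d) + p) + 3 * (p + d)
  Y-step = solve-∀

s₂-prefix<F : ∀ k → s₂ (prefix k) < F (4 + 2 * k)
s₂-prefix<F k = <-offset (4 * p + d)
  (trans (proj₁ (s₂-prefix k)) (sym (+-identityʳ _)))
  (trans (F-+ 3 (2 * k)) (trans (cong (λ q → 3 * q + 2 * p) (F[2k+1] k)) (rhs≡ p d)))
  (≤-trans (F[2k-1]-pos k) (≤-trans (m≤n*m d 2) (m≤n+m (2 * d) p)))
  where
  p d : ℕ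
  p = F (2 * k)
  d = F[2k-1] k
  rhs≡ : ∀ p d → 3 * (p + d) + 2 * p ≡ 4 * p + d + (p + 2 * d)
  rhs≡ = solve-∀

s₂-prefix-combination<F : ∀ k i →
  s₂ (prefix k) * F (3 + i) + s₂ (1 + 2 * prefix k) * F (2 + i) < F (6 + 2 * k + i)
s₂-prefix-combination<F k = F-combination< X Z (6 + 2 * k) base₀ base₁
  where
  p d X Z : ℕ
  p = F (2 * k)
  d = F[2k-1] k
  X = s₂ (prefix k)
  Z = s₂ (1 + 2 * prefix k)
  combination≡ : ∀ a b → X * a + Z * b ≡ (4 * p + d) * a + (5 * p + 4 * d) * b
  combination≡ a b = cong₂ (λ x y → x * a + y * b) eqX
    (trans (s₂-double+1 (prefix k)) (trans (cong₂ _+_ eqX (proj₂ (s₂-prefix k))) (X+Y≡ p d)))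
    where
    eqX : X ≡ 4 * p + d
    eqX = proj₁ (s₂-prefix k)
    X+Y≡ : ∀ p d → (4 * p + d) + (p + 3 * d) ≡ 5 * p + 4 * d
    X+Y≡ = solve-∀
  F[m+2k]≡ : ∀ m → F (suc m + 2 * k) ≡ F (suc m) * (p + d) + F m * p
  F[m+2k]≡ m = trans (F-+ m (2 * k)) (cong (λ q → F (suc m) * q + F m * p) (F[2k+1] k))
  base₀ : X * F 3 + Z * F 2 < F (6 + 2 * k)
  base₀ = <-offset (13 * p + 6 * d) (trans (combination≡ 2 1) (lhs≡ p d))
                   (trans (F[m+2k]≡ 5) (rhs≡ p d))
                   (≤-trans (F[2k-1]-pos k) (m≤n*m d 2))
    where
    lhs≡ : ∀ p d → (4 * p + d) * 2 + (5 * p + 4 * d) * 1 ≡ 13 * p + 6 * d + 0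
    lhs≡ = solve-∀
    rhs≡ : ∀ p d → 8 * (p + d) + 5 * p ≡ 13 * p + 6 * d + 2 * d
    rhs≡ = solve-∀
  base₁ : X * F 4 + Z * F 3 < F (7 + 2 * k)
  base₁ = <-offset (21 * p + 11 * d) (trans (combination≡ 3 2) (lhs≡ p d))
                   (trans (F[m+2k]≡ 6) (rhs≡ p d))
                   (F[2k]<2*F[2k-1] k)
    where
    lhs≡ : ∀ p d → (4 * p + d) * 3 + (5 * p + 4 * d) * 2 ≡ 21 * p + 11 * d + p
    lhs≡ = solve-∀
    rhs≡ : ∀ p d → 13 * (p + d) + 8 * p ≡ 21 * p + 11 * d + 2 * d
    rhs≡ = solve-∀

s₂-2^*prefix+<F : ∀ i k t → t < h (1 + i) → s₂ (2 ^ (1 + i) * prefix k + t) < F (4 + i + 2 * k)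
s₂-2^*prefix+<F zero          k zero    _        =
  subst (_< F (4 + 2 * k)) (sym (trans (cong s₂ (+-identityʳ (2 ^ 1 * prefix k))) (s₂-2^* 1 (prefix k))))
        (s₂-prefix<F k)
s₂-2^*prefix+<F (suc zero)    k zero    _        =
  subst (_< F (5 + 2 * k)) (sym (trans (cong s₂ (+-identityʳ (2 ^ 2 * prefix k))) (s₂-2^* 2 (prefix k))))
        (≤-trans (s₂-prefix<F k) (F-mono (3 + 2 * k)))
s₂-2^*prefix+<F zero          k (suc t) (s≤s ())
s₂-2^*prefix+<F (suc zero)    k (suc t) (s≤s ())
s₂-2^*prefix+<F (suc (suc i)) k t       t<h[3+i] with t <? 2 ^ (1 + i)
... | yes t<P = begin-strict
  s₂ (2 ^ (3 + i) * a + t)                            ≡⟨ cong s₂ (regroup P a t) ⟩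
  s₂ (2 ^ (2 + i) * (2 * a) + t)                      ≡⟨ s₂-split (2 + i) (2 * a) t w (m+[n∸m]≡n t≤2P) ⟩
  s₂ (2 * a) * s₂ w + s₂ (1 + 2 * a) * s₂ t           ≡⟨ cong (λ x → x * s₂ w + s₂ (1 + 2 * a) * s₂ t) (s₂-double a) ⟩
  s₂ a * s₂ w + s₂ (1 + 2 * a) * s₂ t
    ≤⟨ +-mono-≤ (*-monoʳ-≤ (s₂ a) (s₂≤F (2 + i) w (m∸n≤m _ t)))
                (*-monoʳ-≤ (s₂ (1 + 2 * a)) (s₂≤F (1 + i) t (<⇒≤ t<P))) ⟩
  s₂ a * F (3 + i) + s₂ (1 + 2 * a) * F (2 + i)       <⟨ s₂-prefix-combination<F k i ⟩
  F (6 + 2 * k + i)                                   ≡⟨ cong F (index≡ i k) ⟩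
  F (6 + i + 2 * k)                                   ∎
  where
  open ≤-Reasoning
  a P w : ℕ
  a = prefix k
  P = 2 ^ (1 + i)
  w = 2 ^ (2 + i) ∸ t
  t≤2P : t ≤ 2 ^ (2 + i)
  t≤2P = ≤-trans (<⇒≤ t<P) (m≤n*m P 2)
  regroup : ∀ P a t → 2 * (2 * P) * a + t ≡ 2 * P * (2 * a) + t
  regroup = solve-∀
  index≡ : ∀ i k → 6 + 2 * k + i ≡ 6 + i + 2 * k
  index≡ = solve-∀
... | no t≮P = begin-strict
  s₂ (2 ^ (3 + i) * a + t)                  ≡⟨ cong (λ x → s₂ (2 ^ (3 + i) * a + x)) P+t′≡t ⟨
  s₂ (2 ^ (3 + i) * a + (P + t′))           ≡⟨ cong s₂ (regroup P a t′) ⟩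
  s₂ (2 ^ (1 + i) * prefix (suc k) + t′)   <⟨ s₂-2^*prefix+<F i (suc k) t′ t′<h ⟩
  F (4 + i + 2 * suc k)                     ≡⟨ cong F (index≡ i k) ⟩
  F (6 + i + 2 * k)                         ∎
  where
  open ≤-Reasoning
  a P t′ : ℕ
  a = prefix k
  P = 2 ^ (1 + i)
  t′ = t ∸ P
  P+t′≡t : P + t′ ≡ t
  P+t′≡t = m+[n∸m]≡n (≮⇒≥ t≮P)
  t′<h : t′ < h (1 + i)
  t′<h = +-cancelˡ-< P t′ (h (1 + i)) (subst₂ _<_ (sym P+t′≡t) (h-step i) t<h[3+i])
  regroup : ∀ P a t′ → 2 * (2 * P) * a + (P + t′) ≡ P * (1 + 4 * a) + t′
  regroup = solve-∀
  index≡ : ∀ i k → 4 + i + 2 * suc k ≡ 6 + i + 2 * k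
  index≡ = solve-∀

lemma29 : (k m n : ℕ) → 4 ≤ m → m < k →
          2 ^ k + 2 ^ (m ∸ 1) ≤ n → n < 2 ^ k + 2 ^ (m ∸ 1) + h (m ∸ 3) →
          s₂ n < F (m + 2) + (k ∸ m) * F m
lemma29 k m@(suc (suc (suc (suc i)))) n _ m<k lo hi = begin-strict
  s₂ n                         ≡⟨ cong s₂ n≡2^[m+e]+r ⟩
  s₂ (2 ^ (m + e) + r)         ≡⟨ s₂-2^[j+e]+ m e r r≤2^m ⟩
  s₂ (2 ^ m + r) + e * s₂ r    <⟨ +-mono-≤-< (s₂≤F (1 + m) (2 ^ m + r) (P+a≤2*P (2 ^ m) r≤2^m))
                                             (*-monoʳ-< e {{>-nonZero (m<n⇒0<n∸m m<k)}} s₂r<F) ⟩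
  F (2 + m) + e * F m          ≡⟨ cong (λ j → F j + e * F m) (+-comm 2 m) ⟩
  F (m + 2) + e * F m          ∎
  where
  open ≤-Reasoning
  e A t r : ℕ
  e = k ∸ m
  A = 2 ^ k + 2 ^ (3 + i)
  t = n ∸ A
  r = 2 ^ (3 + i) + t
  A+t≡n : A + t ≡ n
  A+t≡n = m+[n∸m]≡n lo
  t<h : t < h (1 + i)
  t<h = +-cancelˡ-< A t (h (1 + i)) (subst (_< A + h (1 + i)) (sym A+t≡n) hi)
  n≡2^[m+e]+r : n ≡ 2 ^ (m + e) + r
  n≡2^[m+e]+r = trans (sym A+t≡n) (trans (+-assoc (2 ^ k) _ t)
                  (cong (λ j → 2 ^ j + r) (sym (m+[n∸m]≡n (<⇒≤ m<k)))))
  r≤2^m : r ≤ 2 ^ m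
  r≤2^m = P+a≤2*P (2 ^ (3 + i)) (≤-trans (<⇒≤ t<h) (≤-trans (h≤2^ i) (^-monoʳ-≤ 2 (m≤n+m (1 + i) 2))))
  s₂r<F : s₂ r < F m
  s₂r<F = subst₂ _<_ (cong s₂ (P*4+t≡2*[2*P]+t (2 ^ (1 + i)) t)) (cong F (+-identityʳ m))
                     (s₂-2^*prefix+<F i 0 t t<h)
    where
    P*4+t≡2*[2*P]+t : ∀ P t → P * 4 + t ≡ 2 * (2 * P) + t
    P*4+t≡2*[2*P]+t = solve-∀
lemma29 k 0 n () _
lemma29 k 1 n (s≤s ()) _
lemma29 k 2 n (s≤s (s≤s ())) _
lemma29 k 3 n (s≤s (s≤s (s≤s ()))) _
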